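{- $G(0)=0$, $G(1)=1$, and $G(n)\le n-2$ for every integer $n\ge2$.
   Context: For partitions write $\mu\le\lambda$ if $\mu_i\le\lambda_i$ for all $i$. For $\lambda\vdash n$ and $0\le k\le n$, a $k$-minor of $\lambda$ is a partition $\mu\vdash n-k$ with $\mu\le\lambda$; $N(\lambda/\mu)$ is the number of standard Young tableaux of skew shape $\lambda/\mu$; $\widehat{M}_k(\lambda)$ is the multiset of $k$-minors $\mu$ of $\lambda$ with multiplicity $N(\lambda/\mu)$. Multiset-reconstructibility holds for $(n,k)$ if for all $\mu,\nu\vdash n$, $\widehat{M}_k(\mu)=\widehat{M}_k(\nu)$ implies $\mu=\nu$. $G(n)$ is the largest $k\in\{0,\dots,n\}$ such that multiset-reconstructibility holds for $(n,k)$ (it then holds for $(n,k)$ exactly when $k\le G(n)$). -}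

module Defs where

open import Data.Bool using (Bool; true; false; if_then_else_)
open import Data.Nat using (ℕ; zero; suc; _+_; _∸_; _≤_; _<_; _≟_; _≤?_; _≥?_; _<?_)
open import Data.List using (List; []; _∷_; length; upTo; map)
open import Data.Nat.ListAction using (sum)
open import Data.List.Properties using (≡-dec)
open import Data.List.Relation.Unary.All using (All; all?)
open import Data.List.Relation.Unary.Linked using (Linked; linked?)
open import Data.Product using (_×_; _,_; Σ)
open import Relation.Nullary using (Dec; yes; no; ¬_; does)
open import Relation.Nullary.Decidable using (_×-dec_)
open import Relation.Binary.PropositionalEquality using (_≡_)

-- A partition is a weakly decreasing list of positive naturals
-- (no trailing zeros, so list equality = equality of partitions).
IsPartition : List ℕ → Set
IsPartition l = Linked (λ a b → b ≤ a) l × All (λ a → 0 < a) l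

isPartition? : (l : List ℕ) → Dec (IsPartition l)
isPartition? l = linked? (λ a b → b ≤? a) l ×-dec all? (λ a → 0 <? a) l

_⊢_ : List ℕ → ℕ → Set
l ⊢ n = IsPartition l × sum l ≡ n

-- μ ≤ λ componentwise, lists padded with zeros
data _≤ₚ_ : List ℕ → List ℕ → Set where
  []≤   : ∀ {ys} → [] ≤ₚ ys
  ∷≤[]  : ∀ {x xs} → x ≡ 0 → xs ≤ₚ [] → (x ∷ xs) ≤ₚ []
  ∷≤∷   : ∀ {x y xs ys} → x ≤ y → xs ≤ₚ ys → (x ∷ xs) ≤ₚ (y ∷ ys)

_≤ₚ?_ : (xs ys : List ℕ) → Dec (xs ≤ₚ ys)
[] ≤ₚ? ys = yes []≤
(x ∷ xs) ≤ₚ? [] with x ≟ 0 | xs ≤ₚ? []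
... | yes p | yes q = yes (∷≤[] p q)
... | no ¬p | _ = no λ { (∷≤[] p q) → ¬p p }
... | _ | no ¬q = no λ { (∷≤[] p q) → ¬q q }
(x ∷ xs) ≤ₚ? (y ∷ ys) with x ≤? y | xs ≤ₚ? ys
... | yes p | yes q = yes (∷≤∷ p q)
... | no ¬p | _ = no λ { (∷≤∷ p q) → ¬p p }
... | _ | no ¬q = no λ { (∷≤∷ p q) → ¬q q }

-- add one cell in row i (rows indexed from 0; i = length appends a new row)
addAt : ℕ → List ℕ → List ℕ
addAt zero    []       = 1 ∷ []
addAt zero    (x ∷ xs) = suc x ∷ xs
addAt (suc i) []       = 0 ∷ addAt i []
addAt (suc i) (x ∷ xs) = x ∷ addAt i xs

-- A standard Young tableau of skew shape λ/μ with k cells is the same as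
-- a chain μ = ν₀ ⊂ ν₁ ⊂ … ⊂ ν_k = λ of partitions, each obtained from the
-- previous by adding one cell (the cell containing entry j is ν_j / ν_{j-1}).
-- chains f μ λ counts such chains of length f.
chains : ℕ → List ℕ → List ℕ → ℕ
chains zero    μ lam = if does (≡-dec _≟_ μ lam) then 1 else 0
chains (suc f) μ lam = sum (map step (upTo (suc (length μ))))
  where
  step : ℕ → ℕ
  step i = if does (isPartition? (addAt i μ)) then
             (if does (addAt i μ ≤ₚ? lam) then chains f (addAt i μ) lam else 0)
           else 0

N : List ℕ → List ℕ → ℕ
N lam μ = chains (sum lam ∸ sum μ) μ lam

-- multiplicity of μ in the multiset \hat M_k(λ) (for μ ⊢ n - k)
mult : List ℕ → List ℕ → ℕ
mult lam μ = if does (μ ≤ₚ? lam) then N lam μ else 0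

SameMinorMultiset : ℕ → ℕ → List ℕ → List ℕ → Set
SameMinorMultiset n k lam nu = ∀ μ → μ ⊢ (n ∸ k) → mult lam μ ≡ mult nu μ

MultisetReconstructible : ℕ → ℕ → Set
MultisetReconstructible n k =
  ∀ lam nu → lam ⊢ n → nu ⊢ n → SameMinorMultiset n k lam nu → lam ≡ nu

IsG : ℕ → ℕ → Set
IsG n g = g ≤ n × MultisetReconstructible n g
          × (∀ k → g < k → k ≤ n → ¬ MultisetReconstructible n k)

module Submission where

-- Write row n = (n) and column n = (1ⁿ).
--  * Every partition of m ≤ 1 is row m = column m.  Hence for n ∈ {0,1} there
--    is only one partition of n, every k is reconstructible, and G(n) = n.
--  * A skew shape row n / row m (and likewise column n / column m) admits
--    exactly one standard filling, since at every step exactly one cell can be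
--    added.  So for n ∸ k ≤ 1 the only (n-k)-minor, row (n ∸ k), occurs with
--    multiplicity 1 in both M̂ₖ(row n) and M̂ₖ(column n).  For n ≥ 2 these two
--    partitions differ, so (n,k) is not reconstructible when k ≥ n - 1.
--  * k = 0 is always reconstructible: λ is the unique 0-minor of itself.
--  * Reconstructibility of (n,k) is decidable (all quantifiers range over the
--    finitely many partitions of n and of n - k), so the largest reconstructible
--    k ≤ n exists; by the previous points it is at most n - 2 when n ≥ 2.
-- The file develops these facts in this order and concludes with the theorem.

open import Defs
open import Data.Nat using (ℕ; zero; suc; _+_; _∸_; _≤_; _<_; z≤n; s≤s; _≟_; _≤?_)
open import Data.Nat.Properties
open import Data.Bool using (false; true; if_then_else_)
open import Data.List using (List; []; _∷_; length; upTo; map; replicate; _++_)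
open import Data.Nat.ListAction using (sum)
open import Data.Nat.ListAction.Properties using (sum-++)
open import Data.List.Properties using (≡-dec; map-++; length-replicate; upTo-∷ʳ)
open import Data.List.Relation.Unary.All as All using (All; all?; []; _∷_)
open import Data.List.Relation.Unary.Linked using ([]; [-]; _∷_)
open import Data.List.Relation.Unary.Any using (here; there)
open import Data.List.Membership.Propositional using (_∈_)
open import Data.List.Membership.Propositional.Properties using (∈-++⁺ˡ; ∈-++⁺ʳ; ∈-map⁺)
open import Data.Product using (_×_; _,_; Σ)
open import Data.Sum using (inj₁; inj₂)
open import Data.Empty using (⊥-elim)
open import Relation.Nullary using (Dec; yes; no; ¬_; does)
open import Relation.Nullary.Decidable using (dec-true; dec-false; _×-dec_; _→-dec_)
open import Relation.Binary.PropositionalEquality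

row : ℕ → List ℕ
row zero    = []
row (suc n) = suc n ∷ []

column : ℕ → List ℕ
column n = replicate n 1

row-partition : ∀ n → IsPartition (row n)
row-partition zero    = [] , []
row-partition (suc n) = [-] , (s≤s z≤n ∷ [])

column-partition : ∀ n → IsPartition (column n)
column-partition zero          = [] , []
column-partition (suc zero)    = [-] , (s≤s z≤n ∷ [])
column-partition (suc (suc n)) with column-partition (suc n)
... | decreasing , positive = ≤-refl ∷ decreasing , s≤s z≤n ∷ positive

sum-row : ∀ n → sum (row n) ≡ n
sum-row zero    = refl
sum-row (suc n) = cong suc (+-identityʳ n)

sum-column : ∀ n → sum (column n) ≡ n
sum-column zero    = refl
sum-column (suc n) = cong suc (sum-column n)

row-⊢ : ∀ n → row n ⊢ n
row-⊢ n = row-partition n , sum-row n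

column-⊢ : ∀ n → column n ⊢ n
column-⊢ n = column-partition n , sum-column n

row≢column : ∀ n → 2 ≤ n → row n ≢ column n
row≢column (suc zero)    (s≤s ())
row≢column (suc (suc n)) _ ()

positive-sum-zero : ∀ l → All (0 <_) l → sum l ≡ 0 → l ≡ []
positive-sum-zero []          _       _  = refl
positive-sum-zero (suc x ∷ l) (_ ∷ _) ()

small-partition : ∀ m μ → m ≤ 1 → μ ⊢ m → μ ≡ row m
small-partition zero μ _ ((_ , positive) , sum≡0) = positive-sum-zero μ positive sum≡0
small-partition (suc zero) [] _ (_ , ())
small-partition (suc zero) (suc x ∷ l) _ ((_ , (_ ∷ positive)) , sum≡1)
  with m+n≡0⇒m≡0 x (suc-injective sum≡1)
     | positive-sum-zero l positive (m+n≡0⇒n≡0 x (suc-injective sum≡1))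
... | refl | refl = refl
small-partition (suc (suc m)) μ (s≤s ()) _

≤ₚ-refl : ∀ l → l ≤ₚ l
≤ₚ-refl []      = []≤
≤ₚ-refl (x ∷ l) = ∷≤∷ ≤-refl (≤ₚ-refl l)

-- The summand of chains (suc f) μ λ for the cell added in row i; it agrees
-- definitionally with the local summand in the definition of chains.
step : ℕ → List ℕ → List ℕ → ℕ → ℕ
step f μ lam i = if does (isPartition? (addAt i μ)) then
                   (if does (addAt i μ ≤ₚ? lam) then chains f (addAt i μ) lam else 0)
                 else 0

chains-zero-refl : ∀ lam → chains 0 lam lam ≡ 1
chains-zero-refl lam rewrite dec-true (≡-dec _≟_ lam lam) refl = refl

chains-zero-≡ : ∀ μ lam → chains 0 μ lam ≡ 1 → μ ≡ lam
chains-zero-≡ μ lam h with ≡-dec _≟_ μ lam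
... | yes μ≡lam = μ≡lam
... | no  _     = ⊥-elim (0≢1+n h)

step-blocked : ∀ f μ lam i → ¬ addAt i μ ≤ₚ lam → step f μ lam i ≡ 0
step-blocked f μ lam i ¬le with does (isPartition? (addAt i μ))
... | false = refl
... | true  rewrite dec-false (addAt i μ ≤ₚ? lam) ¬le = refl

step-allowed : ∀ f μ lam i → IsPartition (addAt i μ) → addAt i μ ≤ₚ lam →
               step f μ lam i ≡ chains f (addAt i μ) lam
step-allowed f μ lam i part le
  rewrite dec-true (isPartition? (addAt i μ)) part | dec-true (addAt i μ ≤ₚ? lam) le = refl

sum-upTo-suc : ∀ (h : ℕ → ℕ) m → sum (map h (upTo (suc m))) ≡ sum (map h (upTo m)) + h m
sum-upTo-suc h m = begin
  sum (map h (upTo (suc m)))          ≡⟨ cong (λ xs → sum (map h xs)) (sym (upTo-∷ʳ m)) ⟩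
  sum (map h (upTo m ++ m ∷ []))      ≡⟨ cong sum (map-++ h (upTo m) (m ∷ [])) ⟩
  sum (map h (upTo m) ++ h m ∷ [])    ≡⟨ sum-++ (map h (upTo m)) (h m ∷ []) ⟩
  sum (map h (upTo m)) + (h m + 0)    ≡⟨ cong (sum (map h (upTo m)) +_) (+-identityʳ (h m)) ⟩
  sum (map h (upTo m)) + h m          ∎
  where open ≡-Reasoning

sum-upTo-zero : ∀ (h : ℕ → ℕ) m → (∀ j → j < m → h j ≡ 0) → sum (map h (upTo m)) ≡ 0
sum-upTo-zero h zero    _    = refl
sum-upTo-zero h (suc m) vanish rewrite sum-upTo-suc h m
  | sum-upTo-zero h m (λ j j<m → vanish j (m<n⇒m<1+n j<m)) | vanish m ≤-refl = refl

sum-upTo-single : ∀ (h : ℕ → ℕ) m i → i < m → (∀ j → j < m → j ≢ i → h j ≡ 0) →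
                  sum (map h (upTo m)) ≡ h i
sum-upTo-single h (suc m) i (s≤s i≤m) others rewrite sum-upTo-suc h m
  with m≤n⇒m<n∨m≡n i≤m
... | inj₁ i<m rewrite sum-upTo-single h m i i<m (λ j j<m → others j (m<n⇒m<1+n j<m))
                     | others m ≤-refl (>⇒≢ i<m) = +-identityʳ (h i)
... | inj₂ refl rewrite sum-upTo-zero h i (λ j j<i → others j (m<n⇒m<1+n j<i) (<⇒≢ j<i)) = refl

chains-forced-step : ∀ f μ lam ν i → i < suc (length μ) → addAt i μ ≡ ν →
                     IsPartition ν → ν ≤ₚ lam →
                     (∀ j → j < suc (length μ) → j ≢ i → ¬ addAt j μ ≤ₚ lam) →
                     chains (suc f) μ lam ≡ chains f ν lam
chains-forced-step f μ lam ν i i< refl part le others =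
  trans (sum-upTo-single (step f μ lam) (suc (length μ)) i i<
           (λ j j< j≢i → step-blocked f μ lam j (others j j< j≢i)))
        (step-allowed f μ lam i part le)

row-≤ : ∀ {m n} → m ≤ n → row m ≤ₚ row n
row-≤ {zero}          _   = []≤
row-≤ {suc m} {suc n} m≤n = ∷≤∷ m≤n []≤

column-≤ : ∀ {m n} → m ≤ n → column m ≤ₚ column n
column-≤ {zero}          _         = []≤
column-≤ {suc m} {suc n} (s≤s m≤n) = ∷≤∷ ≤-refl (column-≤ m≤n)

addAt-row : ∀ m → addAt 0 (row m) ≡ row (suc m)
addAt-row zero    = refl
addAt-row (suc m) = refl

addAt-column : ∀ m → addAt m (column m) ≡ column (suc m)
addAt-column zero    = refl
addAt-column (suc m) = cong (1 ∷_) (addAt-column m)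

row-blocked : ∀ m n j → j < suc (length (row m)) → j ≢ 0 → ¬ addAt j (row m) ≤ₚ row n
row-blocked zero    n       zero          _               j≢0 _ = j≢0 refl
row-blocked zero    n       (suc j)       (s≤s ())        _   _
row-blocked (suc m) n       zero          _               j≢0 _ = j≢0 refl
row-blocked (suc m) zero    (suc zero)    _               _   (∷≤[] () _)
row-blocked (suc m) (suc n) (suc zero)    _               _   (∷≤∷ _ (∷≤[] () _))
row-blocked (suc m) n       (suc (suc j)) (s≤s (s≤s ())) _   _

column-blocked : ∀ m n j → j < m → ¬ addAt j (column m) ≤ₚ column n
column-blocked (suc m) zero    zero    _         (∷≤[] () _)
column-blocked (suc m) (suc n) zero    _         (∷≤∷ (s≤s ()) _)
column-blocked (suc m) zero    (suc j) _         (∷≤[] () _)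
column-blocked (suc m) (suc n) (suc j) (s≤s j<m) (∷≤∷ _ le) = column-blocked m n j j<m le

chains-row : ∀ f m → chains f (row m) (row (m + f)) ≡ 1
chains-row zero m rewrite +-identityʳ m = chains-zero-refl (row m)
chains-row (suc f) m = begin
  chains (suc f) (row m) (row (m + suc f)) ≡⟨ chains-forced-step f (row m) (row (m + suc f))
                                                (row (suc m)) 0 (s≤s z≤n) (addAt-row m)
                                                (row-partition (suc m)) (row-≤ m<m+1+f)
                                                (λ j j< → row-blocked m (m + suc f) j j<) ⟩
  chains f (row (suc m)) (row (m + suc f)) ≡⟨ cong (λ n → chains f (row (suc m)) (row n)) (+-suc m f) ⟩
  chains f (row (suc m)) (row (suc m + f)) ≡⟨ chains-row f (suc m) ⟩
  1                                        ∎
  where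
  open ≡-Reasoning
  m<m+1+f : suc m ≤ m + suc f
  m<m+1+f = subst (suc m ≤_) (sym (+-suc m f)) (s≤s (m≤m+n m f))

chains-column : ∀ f m → chains f (column m) (column (m + f)) ≡ 1
chains-column zero m rewrite +-identityʳ m = chains-zero-refl (column m)
chains-column (suc f) m = begin
  chains (suc f) (column m) (column (m + suc f))
    ≡⟨ chains-forced-step f (column m) (column (m + suc f)) (column (suc m)) m
         (subst (m <_) (sym (cong suc (length-replicate m))) ≤-refl) (addAt-column m)
         (column-partition (suc m)) (column-≤ m<m+1+f) blocked ⟩
  chains f (column (suc m)) (column (m + suc f)) ≡⟨ cong (λ n → chains f (column (suc m)) (column n)) (+-suc m f) ⟩
  chains f (column (suc m)) (column (suc m + f)) ≡⟨ chains-column f (suc m) ⟩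
  1                                              ∎
  where
  open ≡-Reasoning
  m<m+1+f : suc m ≤ m + suc f
  m<m+1+f = subst (suc m ≤_) (sym (+-suc m f)) (s≤s (m≤m+n m f))
  blocked : ∀ j → j < suc (length (column m)) → j ≢ m → ¬ addAt j (column m) ≤ₚ column (m + suc f)
  blocked j j< j≢m with m≤n⇒m<n∨m≡n (≤-pred (subst (λ l → j < suc l) (length-replicate m) j<))
  ... | inj₁ j<m  = column-blocked m (m + suc f) j j<m
  ... | inj₂ j≡m  = ⊥-elim (j≢m j≡m)

mult-≤ : ∀ lam μ → μ ≤ₚ lam → mult lam μ ≡ N lam μ
mult-≤ lam μ le rewrite dec-true (μ ≤ₚ? lam) le = refl

mult-row : ∀ {m n} → m ≤ n → mult (row n) (row m) ≡ 1
mult-row {m} {n} m≤n rewrite mult-≤ (row n) (row m) (row-≤ m≤n) | sum-row n | sum-row m =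
  subst (λ l → chains (n ∸ m) (row m) (row l) ≡ 1) (m+[n∸m]≡n m≤n) (chains-row (n ∸ m) m)

mult-column : ∀ {m n} → m ≤ n → mult (column n) (column m) ≡ 1
mult-column {m} {n} m≤n rewrite mult-≤ (column n) (column m) (column-≤ m≤n)
  | sum-column n | sum-column m =
  subst (λ l → chains (n ∸ m) (column m) (column l) ≡ 1) (m+[n∸m]≡n m≤n) (chains-column (n ∸ m) m)

row-column-same-minors : ∀ n k → n ∸ k ≤ 1 → SameMinorMultiset n k (row n) (column n)
row-column-same-minors n k small μ μ⊢ rewrite small-partition (n ∸ k) μ small μ⊢ =
  trans (mult-row (m∸n≤m n k))
        (sym (subst (λ ν → mult (column n) ν ≡ 1) (sym (row≡column (n ∸ k) small))
                    (mult-column (m∸n≤m n k))))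
  where
  row≡column : ∀ m → m ≤ 1 → row m ≡ column m
  row≡column zero       _ = refl
  row≡column (suc zero) _ = refl
  row≡column (suc (suc m)) (s≤s ())

not-reconstructible : ∀ n k → 2 ≤ n → n ∸ k ≤ 1 → ¬ MultisetReconstructible n k
not-reconstructible n k 2≤n small reconstructible =
  row≢column n 2≤n (reconstructible (row n) (column n) (row-⊢ n) (column-⊢ n)
                      (row-column-same-minors n k small))

mult-self : ∀ lam → mult lam lam ≡ 1
mult-self lam rewrite mult-≤ lam lam (≤ₚ-refl lam) | n∸n≡0 (sum lam) = chains-zero-refl lam

-- Hence λ is recovered from M̂₀(λ) as its unique element: k = 0 is reconstructible.
reconstructible-zero : ∀ n → MultisetReconstructible n 0
reconstructible-zero n lam nu lam⊢@(_ , sum-lam) (_ , sum-nu) same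
  with does (lam ≤ₚ? nu) | trans (sym (same lam lam⊢)) (mult-self lam)
... | false | ()
... | true  | chain rewrite sum-lam | sum-nu | n∸n≡0 n = chains-zero-≡ lam nu chain

unique-partition-reconstructible : ∀ n p → (∀ lam → lam ⊢ n → lam ≡ p) →
                                   ∀ k → MultisetReconstructible n k
unique-partition-reconstructible n p unique k lam nu lam⊢ nu⊢ _ =
  trans (unique lam lam⊢) (sym (unique nu nu⊢))

prepend-upTo : ℕ → List (List ℕ) → List (List ℕ)
prepend-upTo zero    ls = map (0 ∷_) ls
prepend-upTo (suc B) ls = map (suc B ∷_) ls ++ prepend-upTo B ls

prepend-upTo-∈ : ∀ B {x l ls} → x ≤ B → l ∈ ls → (x ∷ l) ∈ prepend-upTo B ls
prepend-upTo-∈ zero    {zero} z≤n l∈ = ∈-map⁺ (0 ∷_) l∈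
prepend-upTo-∈ (suc B) x≤ l∈ with m≤n⇒m<n∨m≡n x≤
... | inj₂ refl      = ∈-++⁺ˡ (∈-map⁺ (suc B ∷_) l∈)
... | inj₁ (s≤s x≤B) = ∈-++⁺ʳ (map (suc B ∷_) _) (prepend-upTo-∈ B x≤B l∈)

bounded-lists : ℕ → ℕ → List (List ℕ)
bounded-lists zero    B = [] ∷ []
bounded-lists (suc L) B = [] ∷ prepend-upTo B (bounded-lists L B)

bounded-lists-∈ : ∀ L B l → length l ≤ L → All (_≤ B) l → l ∈ bounded-lists L B
bounded-lists-∈ zero    B []      _         _          = here refl
bounded-lists-∈ (suc L) B []      _         _          = here refl
bounded-lists-∈ (suc L) B (x ∷ l) (s≤s len) (x≤ ∷ l≤) =
  there (prepend-upTo-∈ B x≤ (bounded-lists-∈ L B l len l≤))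

length≤sum : ∀ l → All (0 <_) l → length l ≤ sum l
length≤sum []      []           = z≤n
length≤sum (x ∷ l) (0<x ∷ 0<l) = +-mono-≤ 0<x (length≤sum l 0<l)

entries≤sum : ∀ l → All (_≤ sum l) l
entries≤sum []      = []
entries≤sum (x ∷ l) = m≤m+n x (sum l)
                    ∷ All.map (λ y≤ → ≤-trans y≤ (m≤n+m (sum l) x)) (entries≤sum l)

-- A partition of n has at most n parts, each at most n.
partition-∈ : ∀ n l → l ⊢ n → l ∈ bounded-lists n n
partition-∈ n l ((_ , positive) , refl) =
  bounded-lists-∈ (sum l) (sum l) l (length≤sum l positive) (entries≤sum l)

_⊢?_ : ∀ l n → Dec (l ⊢ n)
l ⊢? n = isPartition? l ×-dec (sum l ≟ n)

all-partitions? : ∀ n (P : List ℕ → Set) → (∀ l → Dec (P l)) → Dec (∀ l → l ⊢ n → P l)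
all-partitions? n P P? with all? (λ l → (l ⊢? n) →-dec P? l) (bounded-lists n n)
... | yes holds = yes (λ l l⊢ → All.lookup holds (partition-∈ n l l⊢) l⊢)
... | no  fails = no (λ P-all → fails (All.tabulate (λ {l} _ → P-all l)))

reconstructible? : ∀ n k → Dec (MultisetReconstructible n k)
reconstructible? n k
  with all-partitions? n (λ lam → ∀ nu → nu ⊢ n → SameMinorMultiset n k lam nu → lam ≡ nu)
         (λ lam → all-partitions? n _ (λ nu → same? lam nu →-dec ≡-dec _≟_ lam nu))
  where
  same? : ∀ lam nu → Dec (SameMinorMultiset n k lam nu)
  same? lam nu = all-partitions? (n ∸ k) _ (λ μ → mult lam μ ≟ mult nu μ)
... | yes holds = yes (λ lam nu lam⊢ nu⊢ same → holds lam lam⊢ nu nu⊢ same)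
... | no  fails = no (λ r → fails (λ lam lam⊢ nu nu⊢ same → r lam nu lam⊢ nu⊢ same))

largest-witness : (P : ℕ → Set) → (∀ k → Dec (P k)) → P 0 → ∀ m →
                  Σ ℕ (λ g → g ≤ m × P g × (∀ k → g < k → k ≤ m → ¬ P k))
largest-witness P P? P0 zero = 0 , z≤n , P0 , λ k 0<k k≤0 → ⊥-elim (<⇒≱ 0<k k≤0)
largest-witness P P? P0 (suc m) with P? (suc m)
... | yes Pm = suc m , ≤-refl , Pm , λ k m<k k≤m → ⊥-elim (<⇒≱ m<k k≤m)
... | no ¬Pm with largest-witness P P? P0 m
... | g , g≤m , Pg , above = g , m≤n⇒m≤1+n g≤m , Pg , above′
  where
  above′ : ∀ k → g < k → k ≤ suc m → ¬ P k
  above′ k g<k k≤ with m≤n⇒m<n∨m≡n k≤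
  ... | inj₁ (s≤s k≤m) = above k g<k k≤m
  ... | inj₂ refl      = ¬Pm

G-exists : ∀ n → Σ ℕ (IsG n)
G-exists n with largest-witness (MultisetReconstructible n) (reconstructible? n)
                  (reconstructible-zero n) n
... | g , g≤n , Rg , above = g , g≤n , Rg , above

G-top : ∀ n → MultisetReconstructible n n → IsG n n
G-top n Rn = ≤-refl , Rn , λ k n<k k≤n → ⊥-elim (<⇒≱ n<k k≤n)

reconstructible-bound : ∀ n g → 2 ≤ n → g ≤ n → MultisetReconstructible n g → g ≤ n ∸ 2
reconstructible-bound n g 2≤n g≤n Rg with n ∸ g ≤? 1
... | yes small = ⊥-elim (not-reconstructible n g 2≤n small Rg)
... | no  large = m+n≤o⇒m≤o∸n g (subst (_≤ n) (+-comm 2 g) (m≤o∸n⇒m+n≤o 2 g≤n (≰⇒> large)))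

proposition6p1 : IsG 0 0 × IsG 1 1
    × (∀ n → 2 ≤ n → Σ ℕ (λ g → IsG n g × g ≤ n ∸ 2))
proposition6p1 =
  G-top 0 (unique-partition-reconstructible 0 (row 0) (λ l → small-partition 0 l z≤n) 0) ,
  G-top 1 (unique-partition-reconstructible 1 (row 1) (λ l → small-partition 1 l ≤-refl) 1) ,
  G-at-most-n-2
  where
  G-at-most-n-2 : ∀ n → 2 ≤ n → Σ ℕ (λ g → IsG n g × g ≤ n ∸ 2)
  G-at-most-n-2 n 2≤n with G-exists n
  ... | g , isG@(g≤n , Rg , _) = g , isG , reconstructible-bound n g 2≤n g≤n Rg
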